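{- Let $M$ be a multisymmetric matroid on $\widetilde E=\widetilde E_1\sqcup\cdots\sqcup\widetilde E_n$, and let $P$ be the polymatroid on $E=\{1,\dots,n\}$ with rank function $\mathrm{rk}_P(A)=\mathrm{rk}_M(\bigcup_{i\in A}\widetilde E_i)$. Let $\pi:\widetilde E\to E$ be given by $\pi^{ -1}(i)=\widetilde E_i$. Then a subset $F\subseteq E$ is a flat of $P$ if and only if $\pi^{ -1}(F)$ is a geometric flat of $M$, and $F\mapsto\pi^{ -1}(F)$ is a lattice isomorphism from $\mathcal L_P$ to the lattice $\mathcal L_M^\Gamma$ of geometric flats of $M$.
   Context: A polymatroid on a finite set $E$ is a function $\mathrm{rk}:2^E\to\mathbb Z_{\ge0}$ that is submodular, monotone, with $\mathrm{rk}(\emptyset)=0$; a matroid additionally has $\mathrm{rk}(A)\le|A|$; all are loopless ($\mathrm{rk}(A)>0$ for nonempty $A$). Flats are subsets maximal among subsets of their rank, forming a lattice $\mathcal L_P$ under inclusion. A multisymmetric matroid is a matroid $M$ on $\widetilde E$ with a partition $\widetilde E=\widetilde E_1\sqcup\cdots\sqcup\widetilde E_n$ into nonempty blocks such that $\Gamma=\mathfrak S_{\widetilde E_1}\times\cdots\times\mathfrak S_{\widetilde E_n}$ maps flats to flats. A subset $S\subseteq\widetilde E$ is geometric if $S=\bigcap_{\gamma\in\Gamma}\gamma\cdot S$ (equivalently, $S$ is a union of blocks $\widetilde E_i$). -}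

module Defs where

open import Data.Nat using (ℕ; _≤_; _<_; _+_)
open import Data.Fin using (Fin)
open import Data.Fin.Subset using (Subset; _∈_; _⊆_; _∩_; _∪_; ∣_∣; Nonempty) renaming (⊥ to ∅)
open import Data.Fin.Permutation using (Permutation′; _⟨$⟩ʳ_; _⟨$⟩ˡ_)
open import Data.Vec using (tabulate; lookup)
open import Data.Product using (_×_; Σ; ∃)
open import Function.Bundles using (_⇔_)
open import Relation.Binary.PropositionalEquality using (_≡_)

RankFn : ℕ → Set
RankFn m = Subset m → ℕ

record IsPolymatroid {m : ℕ} (rk : RankFn m) : Set where
  field
    rk-empty  : rk ∅ ≡ 0
    monotone  : ∀ A B → A ⊆ B → rk A ≤ rk B
    submod    : ∀ A B → rk (A ∪ B) + rk (A ∩ B) ≤ rk A + rk B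

record IsLooplessMatroid {m : ℕ} (rk : RankFn m) : Set where
  field
    polymatroid : IsPolymatroid rk
    bounded     : ∀ A → rk A ≤ ∣ A ∣
    loopless    : ∀ A → Nonempty A → 0 < rk A

IsFlat : {m : ℕ} → RankFn m → Subset m → Set
IsFlat rk F = ∀ G → F ⊆ G → rk G ≡ rk F → G ≡ F

-- The block map π : Ẽ = Fin m → E = Fin n; the block Ẽ_i is π⁻¹(i).
-- Preimage of a subset of E.
preimage : {m n : ℕ} → (Fin m → Fin n) → Subset n → Subset m
preimage π A = tabulate (λ j → lookup A (π j))

InΓ : {m n : ℕ} → (Fin m → Fin n) → Permutation′ m → Set
InΓ π γ = ∀ j → π (γ ⟨$⟩ʳ j) ≡ π j

act : {m : ℕ} → Permutation′ m → Subset m → Subset m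
act γ S = tabulate (λ x → lookup S (γ ⟨$⟩ˡ x))

record IsMultisymmetric {m n : ℕ} (rk : RankFn m) (π : Fin m → Fin n) : Set where
  field
    matroid       : IsLooplessMatroid rk
    blocks-nonempty : ∀ (i : Fin n) → ∃ λ j → π j ≡ i
    flats-to-flats  : ∀ γ → InΓ π γ → ∀ F → IsFlat rk F → IsFlat rk (act γ F)

IsGeometric : {m n : ℕ} → (Fin m → Fin n) → Subset m → Set
IsGeometric π S = ∀ x → (x ∈ S ⇔ (∀ γ → InΓ π γ → x ∈ act γ S))

rkP : {m n : ℕ} → RankFn m → (Fin m → Fin n) → RankFn n
rkP rk π A = rk (preimage π A)

IsGeomFlat : {m n : ℕ} → RankFn m → (Fin m → Fin n) → Subset m → Set
IsGeomFlat rk π S = IsFlat rk S × IsGeometric π S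

IsJoinIn : {k : ℕ} → (Subset k → Set) → Subset k → Subset k → Subset k → Set
IsJoinIn L F G H = L H × F ⊆ H × G ⊆ H × (∀ K → L K → F ⊆ K → G ⊆ K → H ⊆ K)

IsMeetIn : {k : ℕ} → (Subset k → Set) → Subset k → Subset k → Subset k → Set
IsMeetIn L F G H = L H × H ⊆ F × H ⊆ G × (∀ K → L K → K ⊆ F → K ⊆ G → K ⊆ H)

record IsLatticeIso {k l : ℕ} (L₁ : Subset k → Set) (L₂ : Subset l → Set)
                    (f : Subset k → Subset l) : Set where
  field
    maps-into  : ∀ F → L₁ F → L₂ (f F)
    injective  : ∀ F G → L₁ F → L₁ G → f F ≡ f G → F ≡ G
    surjective : ∀ S → L₂ S → ∃ λ F → L₁ F × f F ≡ S
    order      : ∀ F G → L₁ F → L₁ G → (F ⊆ G ⇔ f F ⊆ f G)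
    pres-join  : ∀ F G H → L₁ F → L₁ G → IsJoinIn L₁ F G H → IsJoinIn L₂ (f F) (f G) (f H)
    pres-meet  : ∀ F G H → L₁ F → L₁ G → IsMeetIn L₁ F G H → IsMeetIn L₂ (f F) (f G) (f H)

{-# OPTIONS --safe #-}

-- The closure cl S = S ∪ {x ∣ rk (S ∪ {x}) ≤ rk S} is the least flat containing S.
-- Because Γ maps flats to flats, the closure of a union of blocks is again a union
-- of blocks: if x ∈ cl S and γ transposes x with y in the same block, then γ · cl S
-- is a flat containing S, hence x, so y ∈ cl S. For a flat F of P this gives
-- cl (π⁻¹ F) = π⁻¹ F′ with F ⊆ F′ and rk_P F′ = rk_P F, so F′ = F and π⁻¹ F is a
-- flat. The rest follows because π⁻¹ is an order embedding whose image consists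
-- exactly of the unions of blocks.

module Submission where

open import Defs
open import Data.Bool using (Bool; true)
open import Data.Nat using (ℕ; _≤_; _+_; _≤?_)
open import Data.Nat.Properties using (≤-trans; ≤-antisym; +-comm; +-monoʳ-≤; +-cancelˡ-≤; module ≤-Reasoning)
open import Data.Fin using (Fin; _≟_)
open import Data.Fin.Subset using (Subset; _∈_; _⊆_; _∩_; _∪_; ⁅_⁆; ⋃) renaming (⊥ to ∅)
open import Data.Fin.Subset.Properties
  using (⊆-refl; ⊆-reflexive; ⊆-trans; ⊆-antisym; ⊥⊆; p⊆p∪q; q⊆p∪q; x∈p∪q⁻; x∈p∩q⁺; x∈⁅x⁆; x∈⁅y⁆⇒x≡y)
open import Data.Fin.Permutation using (Permutation′; _⟨$⟩ˡ_; transpose; inverseʳ) renaming (id to idₚ)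
open import Data.Vec using (tabulate; lookup)
open import Data.Vec.Properties using ([]=⇒lookup; lookup⇒[]=; lookup∘tabulate)
open import Data.List using (List; []; _∷_; map; filter; allFin)
open import Data.List.Relation.Unary.All using (All; []; _∷_)
import Data.List.Relation.Unary.All.Properties as All
import Data.List.Membership.Propositional as List
open import Data.List.Membership.Propositional.Properties using (∈-map⁺; ∈-filter⁺; ∈-allFin)
open import Data.List.Relation.Unary.Any using (here; there)
open import Data.Empty using (⊥-elim)
open import Data.Product using (_×_; _,_; proj₁; proj₂; ∃)
open import Data.Sum using ([_,_])
open import Function using (_∘_)
open import Function.Bundles using (_⇔_; mk⇔; Equivalence)
open import Relation.Nullary using (Dec; yes; no)
open import Relation.Binary.PropositionalEquality using (_≡_; refl; sym; trans; cong; subst)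

open Equivalence using (to; from)

∈-tabulate⁺ : ∀ {k} (f : Fin k → Bool) {x} → f x ≡ true → x ∈ tabulate f
∈-tabulate⁺ f {x} fx≡true = lookup⇒[]= x _ (trans (lookup∘tabulate f x) fx≡true)

∈-tabulate⁻ : ∀ {k} (f : Fin k → Bool) {x} → x ∈ tabulate f → f x ≡ true
∈-tabulate⁻ f {x} x∈ = trans (sym (lookup∘tabulate f x)) ([]=⇒lookup x∈)

∪-least : ∀ {k} {A B C : Subset k} → A ⊆ C → B ⊆ C → A ∪ B ⊆ C
∪-least {A = A} {B} A⊆C B⊆C x∈A∪B = [ A⊆C , B⊆C ] (x∈p∪q⁻ A B x∈A∪B)

⁅⁆-⊆ : ∀ {k} {x : Fin k} {A} → x ∈ A → ⁅ x ⁆ ⊆ A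
⁅⁆-⊆ {A = A} x∈A y∈⁅x⁆ = subst (_∈ A) (sym (x∈⁅y⁆⇒x≡y _ y∈⁅x⁆)) x∈A

∈-⋃⁺ : ∀ {k} {x : Fin k} {X Xs} → x ∈ X → X List.∈ Xs → x ∈ ⋃ Xs
∈-⋃⁺ x∈X (here refl)  = p⊆p∪q _ x∈X
∈-⋃⁺ x∈X (there X∈Xs) = q⊆p∪q _ _ (∈-⋃⁺ x∈X X∈Xs)

∈-preimage⁺ : ∀ {m n} (π : Fin m → Fin n) {A x} → π x ∈ A → x ∈ preimage π A
∈-preimage⁺ π {A} πx∈A = ∈-tabulate⁺ (λ j → lookup A (π j)) ([]=⇒lookup πx∈A)

∈-preimage⁻ : ∀ {m n} (π : Fin m → Fin n) {A x} → x ∈ preimage π A → π x ∈ A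
∈-preimage⁻ π {A} {x} x∈ = lookup⇒[]= (π x) A (∈-tabulate⁻ (λ j → lookup A (π j)) x∈)

∈-act⁺ : ∀ {m} (γ : Permutation′ m) {S x} → γ ⟨$⟩ˡ x ∈ S → x ∈ act γ S
∈-act⁺ γ {S} γ⁻¹x∈S = ∈-tabulate⁺ (λ x → lookup S (γ ⟨$⟩ˡ x)) ([]=⇒lookup γ⁻¹x∈S)

∈-act⁻ : ∀ {m} (γ : Permutation′ m) {S x} → x ∈ act γ S → γ ⟨$⟩ˡ x ∈ S
∈-act⁻ γ {S} {x} x∈ = lookup⇒[]= (γ ⟨$⟩ˡ x) S (∈-tabulate⁻ (λ x → lookup S (γ ⟨$⟩ˡ x)) x∈)

transpose⁻¹-apply : ∀ {m} (x y : Fin m) → transpose x y ⟨$⟩ˡ x ≡ y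
transpose⁻¹-apply x y with x ≟ y
... | yes refl = refl
... | no _ with x ≟ x
...   | yes _  = refl
...   | no x≢x = ⊥-elim (x≢x refl)

module PolymatroidClosure {m} {rk : RankFn m} (isPolymatroid : IsPolymatroid rk) where
  open IsPolymatroid isPolymatroid

  rk-∪-absorb : ∀ X A B → X ⊆ A ∩ B → rk B ≤ rk X → rk (A ∪ B) ≤ rk A
  rk-∪-absorb X A B X⊆A∩B rkB≤rkX = +-cancelˡ-≤ (rk (A ∩ B)) _ _ (begin
    rk (A ∩ B) + rk (A ∪ B) ≡⟨ +-comm (rk (A ∩ B)) _ ⟩
    rk (A ∪ B) + rk (A ∩ B) ≤⟨ submod A B ⟩
    rk A + rk B             ≤⟨ +-monoʳ-≤ (rk A) (≤-trans rkB≤rkX (monotone X (A ∩ B) X⊆A∩B)) ⟩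
    rk A + rk (A ∩ B)       ≡⟨ +-comm (rk A) _ ⟩
    rk (A ∩ B) + rk A       ∎)
    where open ≤-Reasoning

  Spans : Subset m → Subset m → Set
  Spans S X = rk (S ∪ X) ≤ rk S

  spans? : ∀ S X → Dec (Spans S X)
  spans? S X = rk (S ∪ X) ≤? rk S

  spans-∪ : ∀ S X Y → Spans S X → Spans S Y → Spans S (X ∪ Y)
  spans-∪ S X Y S-spans-X S-spans-Y = begin
    rk (S ∪ (X ∪ Y))       ≤⟨ monotone _ _ S∪[X∪Y]⊆[S∪X]∪[S∪Y] ⟩
    rk ((S ∪ X) ∪ (S ∪ Y)) ≤⟨ rk-∪-absorb S (S ∪ X) (S ∪ Y) S⊆[S∪X]∩[S∪Y] S-spans-Y ⟩
    rk (S ∪ X)             ≤⟨ S-spans-X ⟩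
    rk S                   ∎
    where
      open ≤-Reasoning
      S∪[X∪Y]⊆[S∪X]∪[S∪Y] : S ∪ (X ∪ Y) ⊆ (S ∪ X) ∪ (S ∪ Y)
      S∪[X∪Y]⊆[S∪X]∪[S∪Y] = ∪-least (⊆-trans (p⊆p∪q X) (p⊆p∪q _))
        (∪-least (⊆-trans (q⊆p∪q S X) (p⊆p∪q _)) (⊆-trans (q⊆p∪q S Y) (q⊆p∪q _ _)))
      S⊆[S∪X]∩[S∪Y] : S ⊆ (S ∪ X) ∩ (S ∪ Y)
      S⊆[S∪X]∩[S∪Y] x∈S = x∈p∩q⁺ (p⊆p∪q X x∈S , p⊆p∪q Y x∈S)

  spans-⋃ : ∀ S Xs → All (Spans S) Xs → Spans S (⋃ Xs)
  spans-⋃ S []       []                      = monotone (S ∪ ∅) S (∪-least ⊆-refl ⊥⊆)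
  spans-⋃ S (X ∷ Xs) (S-spans-X ∷ S-spans-Xs) = spans-∪ S X (⋃ Xs) S-spans-X (spans-⋃ S Xs S-spans-Xs)

  spanned : Subset m → List (Fin m)
  spanned S = filter (spans? S ∘ ⁅_⁆) (allFin m)

  cl : Subset m → Subset m
  cl S = S ∪ ⋃ (map ⁅_⁆ (spanned S))

  ⊆-cl : ∀ S → S ⊆ cl S
  ⊆-cl S = p⊆p∪q _

  spans⇒∈-cl : ∀ S x → Spans S ⁅ x ⁆ → x ∈ cl S
  spans⇒∈-cl S x S-spans-x = q⊆p∪q S _
    (∈-⋃⁺ (x∈⁅x⁆ x) (∈-map⁺ ⁅_⁆ (∈-filter⁺ (spans? S ∘ ⁅_⁆) (∈-allFin x) S-spans-x)))

  rk-cl : ∀ S → rk (cl S) ≤ rk S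
  rk-cl S = spans-⋃ S _ (All.map⁺ (All.all-filter (spans? S ∘ ⁅_⁆) (allFin m)))

  cl-flat : ∀ S → IsFlat rk (cl S)
  cl-flat S G clS⊆G rkG≡rkclS = ⊆-antisym G⊆clS clS⊆G
    where
      open ≤-Reasoning
      G⊆clS : G ⊆ cl S
      G⊆clS {x} x∈G = spans⇒∈-cl S x (begin
        rk (S ∪ ⁅ x ⁆) ≤⟨ monotone _ G (∪-least (⊆-trans (⊆-cl S) clS⊆G) (⁅⁆-⊆ x∈G)) ⟩
        rk G           ≡⟨ rkG≡rkclS ⟩
        rk (cl S)      ≤⟨ rk-cl S ⟩
        rk S           ∎)

  cl-least : ∀ S K → IsFlat rk K → S ⊆ K → cl S ⊆ K
  cl-least S K K-flat S⊆K = subst (cl S ⊆_) K∪clS≡K (q⊆p∪q K (cl S))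
    where
      K∪clS≡K : K ∪ cl S ≡ K
      K∪clS≡K = K-flat (K ∪ cl S) (p⊆p∪q _)
        (≤-antisym (rk-∪-absorb S K (cl S) (λ x∈S → x∈p∩q⁺ (S⊆K x∈S , ⊆-cl S x∈S)) (rk-cl S))
                   (monotone K _ (p⊆p∪q _)))

BlockClosed : ∀ {m n} → (Fin m → Fin n) → Subset m → Set
BlockClosed π S = ∀ {x y} → π x ≡ π y → x ∈ S → y ∈ S

module Blocks {m n} (π : Fin m → Fin n) where

  preimage-mono : ∀ {A B} → A ⊆ B → preimage π A ⊆ preimage π B
  preimage-mono A⊆B x∈ = ∈-preimage⁺ π (A⊆B (∈-preimage⁻ π x∈))

  preimage-blockClosed : ∀ A → BlockClosed π (preimage π A)
  preimage-blockClosed A πx≡πy x∈ = ∈-preimage⁺ π (subst (_∈ A) πx≡πy (∈-preimage⁻ π x∈))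

  InΓ-inverse : ∀ γ → InΓ π γ → ∀ x → π (γ ⟨$⟩ˡ x) ≡ π x
  InΓ-inverse γ γ∈Γ x = trans (sym (γ∈Γ (γ ⟨$⟩ˡ x))) (cong π (inverseʳ γ))

  transpose-InΓ : ∀ {x y} → π x ≡ π y → InΓ π (transpose x y)
  transpose-InΓ {x} {y} πx≡πy j with j ≟ x
  ... | yes refl = sym πx≡πy
  ... | no _ with j ≟ y
  ...   | yes refl = πx≡πy
  ...   | no _     = refl

  ⊆-act : ∀ γ {S T} → InΓ π γ → BlockClosed π S → S ⊆ T → S ⊆ act γ T
  ⊆-act γ γ∈Γ S-closed S⊆T {x} x∈S = ∈-act⁺ γ (S⊆T (S-closed (sym (InΓ-inverse γ γ∈Γ x)) x∈S))

  blockClosed⇒geometric : ∀ {S} → BlockClosed π S → IsGeometric π S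
  blockClosed⇒geometric S-closed x = mk⇔
    (λ x∈S γ γ∈Γ → ⊆-act γ γ∈Γ S-closed ⊆-refl x∈S)
    (λ x∈all → ∈-act⁻ idₚ (x∈all idₚ (λ _ → refl)))

  geometric⇒blockClosed : ∀ {S} → IsGeometric π S → BlockClosed π S
  geometric⇒blockClosed {S} S-geometric {x} {y} πx≡πy x∈S = subst (_∈ S) (transpose⁻¹-apply x y)
    (∈-act⁻ (transpose x y) (to (S-geometric x) x∈S (transpose x y) (transpose-InΓ πx≡πy)))

module SurjectiveBlocks {m n} (π : Fin m → Fin n) (π-surjective : ∀ i → ∃ λ j → π j ≡ i) where
  open Blocks π

  representative : Fin n → Fin m
  representative i = proj₁ (π-surjective i)

  π-representative : ∀ i → π (representative i) ≡ i
  π-representative i = proj₂ (π-surjective i)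

  preimage-reflects-⊆ : ∀ {A B} → preimage π A ⊆ preimage π B → A ⊆ B
  preimage-reflects-⊆ {A} {B} π⁻¹A⊆π⁻¹B {i} i∈A = subst (_∈ B) (π-representative i)
    (∈-preimage⁻ π (π⁻¹A⊆π⁻¹B (∈-preimage⁺ π (subst (_∈ A) (sym (π-representative i)) i∈A))))

  preimage-injective : ∀ {A B} → preimage π A ≡ preimage π B → A ≡ B
  preimage-injective eq = ⊆-antisym (preimage-reflects-⊆ (⊆-reflexive eq)) (preimage-reflects-⊆ (⊆-reflexive (sym eq)))

  preimage-⊆⇔ : ∀ A B → A ⊆ B ⇔ preimage π A ⊆ preimage π B
  preimage-⊆⇔ A B = mk⇔ preimage-mono preimage-reflects-⊆

  blocks : Subset m → Subset n
  blocks S = tabulate (λ i → lookup S (representative i))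

  preimage-blocks : ∀ {S} → BlockClosed π S → preimage π (blocks S) ≡ S
  preimage-blocks {S} S-closed = ⊆-antisym
    (λ {x} x∈ → S-closed (π-representative (π x))
      (lookup⇒[]= _ S (∈-tabulate⁻ (λ i → lookup S (representative i)) (∈-preimage⁻ π x∈))))
    (λ {x} x∈S → ∈-preimage⁺ π (∈-tabulate⁺ (λ i → lookup S (representative i))
      ([]=⇒lookup (S-closed (sym (π-representative (π x))) x∈S))))

module _ {k l} {L₁ : Subset k → Set} {L₂ : Subset l → Set} {f : Subset k → Subset l}
         (maps-into : ∀ F → L₁ F → L₂ (f F))
         (order : ∀ F G → L₁ F → L₁ G → (F ⊆ G ⇔ f F ⊆ f G))
         (surjective : ∀ S → L₂ S → ∃ λ F → L₁ F × f F ≡ S) where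

  orderIso⇒isLatticeIso : IsLatticeIso L₁ L₂ f
  orderIso⇒isLatticeIso = record
    { maps-into  = maps-into
    ; injective  = λ F G F∈L₁ G∈L₁ fF≡fG →
        ⊆-antisym (from (order F G F∈L₁ G∈L₁) (⊆-reflexive fF≡fG))
                  (from (order G F G∈L₁ F∈L₁) (⊆-reflexive (sym fF≡fG)))
    ; surjective = surjective
    ; order      = order
    ; pres-join  = pres-join
    ; pres-meet  = pres-meet
    }
    where
      pres-join : ∀ F G H → L₁ F → L₁ G → IsJoinIn L₁ F G H → IsJoinIn L₂ (f F) (f G) (f H)
      pres-join F G H F∈L₁ G∈L₁ (H∈L₁ , F⊆H , G⊆H , H-least) =
        maps-into H H∈L₁ , to (order F H F∈L₁ H∈L₁) F⊆H , to (order G H G∈L₁ H∈L₁) G⊆H , fH-least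
        where
          fH-least : ∀ K → L₂ K → f F ⊆ K → f G ⊆ K → f H ⊆ K
          fH-least K K∈L₂ fF⊆K fG⊆K with surjective K K∈L₂
          ... | K′ , K′∈L₁ , refl = to (order H K′ H∈L₁ K′∈L₁)
            (H-least K′ K′∈L₁ (from (order F K′ F∈L₁ K′∈L₁) fF⊆K) (from (order G K′ G∈L₁ K′∈L₁) fG⊆K))

      pres-meet : ∀ F G H → L₁ F → L₁ G → IsMeetIn L₁ F G H → IsMeetIn L₂ (f F) (f G) (f H)
      pres-meet F G H F∈L₁ G∈L₁ (H∈L₁ , H⊆F , H⊆G , H-greatest) =
        maps-into H H∈L₁ , to (order H F H∈L₁ F∈L₁) H⊆F , to (order H G H∈L₁ G∈L₁) H⊆G , fH-greatest
        where
          fH-greatest : ∀ K → L₂ K → K ⊆ f F → K ⊆ f G → K ⊆ f H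
          fH-greatest K K∈L₂ K⊆fF K⊆fG with surjective K K∈L₂
          ... | K′ , K′∈L₁ , refl = to (order K′ H K′∈L₁ H∈L₁)
            (H-greatest K′ K′∈L₁ (from (order K′ F K′∈L₁ F∈L₁) K⊆fF) (from (order K′ G K′∈L₁ G∈L₁) K⊆fG))

module Multisymmetric {m n} {rk : RankFn m} {π : Fin m → Fin n} (multisymmetric : IsMultisymmetric rk π) where
  open IsMultisymmetric multisymmetric
  open IsPolymatroid (IsLooplessMatroid.polymatroid matroid)
  open PolymatroidClosure (IsLooplessMatroid.polymatroid matroid)
  open Blocks π
  open SurjectiveBlocks π blocks-nonempty

  cl-blockClosed : ∀ {S} → BlockClosed π S → BlockClosed π (cl S)
  cl-blockClosed {S} S-closed {x} {y} πx≡πy x∈clS = subst (_∈ cl S) (transpose⁻¹-apply x y)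
    (∈-act⁻ γ (cl-least S (act γ (cl S)) (flats-to-flats γ γ∈Γ (cl S) (cl-flat S))
                          (⊆-act γ γ∈Γ S-closed (⊆-cl S)) x∈clS))
    where
      γ : Permutation′ m
      γ = transpose x y
      γ∈Γ : InΓ π γ
      γ∈Γ = transpose-InΓ πx≡πy

  preimage-flat : ∀ F → IsFlat (rkP rk π) F → IsFlat rk (preimage π F)
  preimage-flat F F-flat = subst (IsFlat rk) clS≡S (cl-flat S)
    where
      S : Subset m
      S = preimage π F
      B : Subset n
      B = blocks (cl S)
      preimage-B≡clS : preimage π B ≡ cl S
      preimage-B≡clS = preimage-blocks (cl-blockClosed (preimage-blockClosed F))
      S⊆preimage-B : S ⊆ preimage π B
      S⊆preimage-B = subst (S ⊆_) (sym preimage-B≡clS) (⊆-cl S)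
      B≡F : B ≡ F
      B≡F = F-flat B (preimage-reflects-⊆ S⊆preimage-B)
        (≤-antisym (subst (λ T → rk T ≤ rk S) (sym preimage-B≡clS) (rk-cl S)) (monotone S _ S⊆preimage-B))
      clS≡S : cl S ≡ S
      clS≡S = trans (sym preimage-B≡clS) (cong (preimage π) B≡F)

  flat-of-preimage-flat : ∀ F → IsFlat rk (preimage π F) → IsFlat (rkP rk π) F
  flat-of-preimage-flat F S-flat G F⊆G rkP-G≡rkP-F =
    preimage-injective (S-flat (preimage π G) (preimage-mono F⊆G) rkP-G≡rkP-F)

  flat⇔preimage-geomFlat : ∀ F → IsFlat (rkP rk π) F ⇔ IsGeomFlat rk π (preimage π F)
  flat⇔preimage-geomFlat F = mk⇔
    (λ F-flat → preimage-flat F F-flat , blockClosed⇒geometric (preimage-blockClosed F))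
    (λ (S-flat , _) → flat-of-preimage-flat F S-flat)

  geomFlat⇒preimage-of-flat : ∀ S → IsGeomFlat rk π S → ∃ λ F → IsFlat (rkP rk π) F × preimage π F ≡ S
  geomFlat⇒preimage-of-flat S (S-flat , S-geometric) =
    blocks S , flat-of-preimage-flat (blocks S) (subst (IsFlat rk) (sym S≡) S-flat) , S≡
    where
      S≡ : preimage π (blocks S) ≡ S
      S≡ = preimage-blocks (geometric⇒blockClosed S-geometric)

corollary2p7 : {m n : ℕ} (rk : RankFn m) (π : Fin m → Fin n) →
    IsMultisymmetric rk π →
    (∀ (F : Subset n) → (IsFlat (rkP rk π) F ⇔ IsGeomFlat rk π (preimage π F)))
    × IsLatticeIso (IsFlat (rkP rk π)) (IsGeomFlat rk π) (preimage π)
corollary2p7 rk π multisymmetric =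
  flat⇔preimage-geomFlat ,
  orderIso⇒isLatticeIso (to ∘ flat⇔preimage-geomFlat)
                        (λ F G _ _ → preimage-⊆⇔ F G)
                        geomFlat⇒preimage-of-flat
  where
    open Multisymmetric multisymmetric
    open SurjectiveBlocks π (IsMultisymmetric.blocks-nonempty multisymmetric)
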